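{- The pure type systems $\lambda^{\rightarrow}$ (with $\mathcal S=\mathcal C=\{*,\square\}$, $\mathcal A=\{*:\square\}$, $\mathcal R=\{(*,*,*)\}$) and $\lambda\mathrm P$ (with $\mathcal S=\mathcal C=\{*,\square\}$, $\mathcal A=\{*:\square\}$, $\mathcal R=\{(*,*,*),(*,\square,\square)\}$) each have an equivalent Hilbert-style pure type system, but $\vdash *:\square$ is the only theorem of both systems.
   Context: Pure type systems (PTS): variables, constants $\mathcal C$, sorts $\mathcal S\subseteq\mathcal C$, axioms $\mathcal A$, rules $\mathcal R\subseteq\mathcal S^3$; pseudoterms $\mathcal T::=V\mid\mathcal C\mid\Pi V{:}\mathcal T.\mathcal T\mid\lambda V{:}\mathcal T.\mathcal T\mid\mathcal T\mathcal T$; derivable judgements $\Gamma\vdash M:A$ generated by (axiom) $\vdash c:s$ for $(c:s)\in\mathcal A$; (start) $\Gamma\vdash A:s\Rightarrow\Gamma,x:A\vdash x:A$ ($x$ fresh); (weakening) $\Gamma\vdash M:B$, $\Gamma\vdash A:s\Rightarrow\Gamma,x:A\vdash M:B$ ($x$ fresh); (application) $\Gamma\vdash M:\Pi x{:}A.B$, $\Gamma\vdash N:A\Rightarrow\Gamma\vdash MN:B[x:=N]$; (abstraction) $\Gamma,x:A\vdash M:B$, $\Gamma\vdash(\Pi x{:}A.B):s\Rightarrow\Gamma\vdash(\lambda x{:}A.M):(\Pi x{:}A.B)$; (product) $\Gamma,x:A\vdash B:s_2$, $\Gamma\vdash A:s_1$, $(s_1,s_2,s_3)\in\mathcal R\Rightarrow\Gamma\vdash(\Pi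 x{:}A.B):s_3$; (conversion) $\Gamma\vdash M:A$, $\Gamma\vdash B:s$, $A=_\beta B\Rightarrow\Gamma\vdash M:B$. A theorem is a derivable judgement with empty context. Hilbert-style PTS (HPTS) with specification $(\mathcal S,\mathcal A,\mathcal B)$: same pseudoterms, only empty contexts; derivable judgements generated by the axioms of $\mathcal A$ and of a finite set $\mathcal B$ of axiom schemes (sort variables instantiable by sorts), (application) and (conversion) with empty contexts, (type reduction) $\vdash M:A$, $A\to_\beta B\Rightarrow\vdash M:B$, (subject reduction) $\vdash M:A$, $M\to_\beta N\Rightarrow\vdash N:A$. It is equivalent to the PTS $(\mathcal S,\mathcal A,\mathcal R)$ if both derive exactly the same judgements $\vdash M:A$ with empty context. -}

module Defs where

open import Data.Nat using (ℕ; zero; suc)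
open import Data.List using (List; []; _∷_)
open import Data.List.Membership.Propositional using (_∈_)
open import Data.Product using (Σ; _×_; _,_; proj₁)
open import Data.Sum using (_⊎_; inj₁; inj₂)
open import Data.Unit using (⊤)

-- Pseudoterms over a set of constants C, variables as de Bruijn indices.
--   T ::= V | C | Π V:T.T | λ V:T.T | T T
-- In `pi A B` and `lam A M` the body B / M binds index 0.

data Term (C : Set) : Set where
  var   : ℕ → Term C
  const : C → Term C
  pi    : Term C → Term C → Term C
  lam   : Term C → Term C → Term C
  app   : Term C → Term C → Term C

module _ {C : Set} where

  shiftVar : ℕ → ℕ → ℕ
  shiftVar zero    n       = suc n
  shiftVar (suc c) zero    = zero
  shiftVar (suc c) (suc n) = suc (shiftVar c n)

  shiftFrom : ℕ → Term C → Term C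
  shiftFrom c (var n)   = var (shiftVar c n)
  shiftFrom c (const k) = const k
  shiftFrom c (pi A B)  = pi (shiftFrom c A) (shiftFrom (suc c) B)
  shiftFrom c (lam A M) = lam (shiftFrom c A) (shiftFrom (suc c) M)
  shiftFrom c (app M N) = app (shiftFrom c M) (shiftFrom c N)

  shift : Term C → Term C
  shift = shiftFrom 0

  -- substVar c N n : result of substituting N for index c in variable n
  -- (indices above c are decremented, N is shifted under binders)
  substVar : ℕ → Term C → ℕ → Term C
  substVar zero    N zero    = N
  substVar zero    N (suc n) = var n
  substVar (suc c) N zero    = var zero
  substVar (suc c) N (suc n) = shift (substVar c N n)

  substAt : ℕ → Term C → Term C → Term C
  substAt c N (var n)   = substVar c N n
  substAt c N (const k) = const k
  substAt c N (pi A B)  = pi (substAt c N A) (substAt (suc c) N B)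
  substAt c N (lam A M) = lam (substAt c N A) (substAt (suc c) N M)
  substAt c N (app M P) = app (substAt c N M) (substAt c N P)

  _[_] : Term C → Term C → Term C
  B [ N ] = substAt 0 N B

  infix 4 _→β_ _=β_

  data _→β_ : Term C → Term C → Set where
    beta  : ∀ {A M N} → app (lam A M) N →β (M [ N ])
    piL   : ∀ {A A' B} → A →β A' → pi A B →β pi A' B
    piR   : ∀ {A B B'} → B →β B' → pi A B →β pi A B'
    lamL  : ∀ {A A' M} → A →β A' → lam A M →β lam A' M
    lamR  : ∀ {A M M'} → M →β M' → lam A M →β lam A M'
    appL  : ∀ {M M' N} → M →β M' → app M N →β app M' N
    appR  : ∀ {M N N'} → N →β N' → app M N →β app M N'

  data _=β_ : Term C → Term C → Set where
    red   : ∀ {M N} → M →β N → M =β N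
    refl= : ∀ {M} → M =β M
    sym=  : ∀ {M N} → M =β N → N =β M
    trans= : ∀ {M N P} → M =β N → N =β P → M =β P

-- PTS specifications (S ⊆ C given by a predicate IsSort)

record PTSSpec : Set₁ where
  field
    Const  : Set
    IsSort : Const → Set
    Axiom  : Const → Const → Set
    Rule   : Const → Const → Const → Set

module PTS (P : PTSSpec) where
  open PTSSpec P

  Tm : Set
  Tm = Term Const

  Context : Set
  Context = List Tm   -- most recent declaration at the head (index 0)

  infix 3 _⊢_∶_

  data _⊢_∶_ : Context → Tm → Tm → Set where
    axiom : ∀ {c s} → Axiom c s → [] ⊢ const c ∶ const s
    start : ∀ {Γ A s} → IsSort s → Γ ⊢ A ∶ const s →
            (A ∷ Γ) ⊢ var 0 ∶ shift A
    weakening : ∀ {Γ M B A s} → IsSort s → Γ ⊢ M ∶ B → Γ ⊢ A ∶ const s →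
            (A ∷ Γ) ⊢ shift M ∶ shift B
    application : ∀ {Γ M N A B} → Γ ⊢ M ∶ pi A B → Γ ⊢ N ∶ A →
            Γ ⊢ app M N ∶ (B [ N ])
    abstraction : ∀ {Γ A M B s} → IsSort s → (A ∷ Γ) ⊢ M ∶ B →
            Γ ⊢ pi A B ∶ const s → Γ ⊢ lam A M ∶ pi A B
    product : ∀ {Γ A B s₁ s₂ s₃} → (A ∷ Γ) ⊢ B ∶ const s₂ → Γ ⊢ A ∶ const s₁ →
            Rule s₁ s₂ s₃ → Γ ⊢ pi A B ∶ const s₃
    conversion : ∀ {Γ M A B s} → IsSort s → Γ ⊢ M ∶ A → Γ ⊢ B ∶ const s →
            A =β B → Γ ⊢ M ∶ B

  Theorem : Tm → Tm → Set
  Theorem M A = [] ⊢ M ∶ A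

-- Hilbert-style PTS with specification (S, 𝒜, ℬ): ℬ a finite list of
-- axiom schemes; a scheme is a pair (M , A) of pseudoterms over the
-- constants extended by sort variables (indexed by ℕ), which may be
-- instantiated by arbitrary sorts.

module _ {C : Set} where
  mapConst : {D : Set} → (C → Term D) → Term C → Term D
  mapConst f (var n)   = var n
  mapConst f (const k) = f k
  mapConst f (pi A B)  = pi (mapConst f A) (mapConst f B)
  mapConst f (lam A M) = lam (mapConst f A) (mapConst f M)
  mapConst f (app M N) = app (mapConst f M) (mapConst f N)

module HPTS (P : PTSSpec) where
  open PTSSpec P

  Tm : Set
  Tm = Term Const

  SchemeTm : Set
  SchemeTm = Term (Const ⊎ ℕ)

  Scheme : Set
  Scheme = SchemeTm × SchemeTm

  SortInst : Set
  SortInst = ℕ → Σ Const IsSort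

  instantiate : SortInst → SchemeTm → Tm
  instantiate σ = mapConst f
    where
      f : Const ⊎ ℕ → Tm
      f (inj₁ c) = const c
      f (inj₂ i) = const (proj₁ (σ i))

  infix 3 ⊢_∶_within_

  data ⊢_∶_within_ : Tm → Tm → List Scheme → Set where
    axiom : ∀ {ℬ c s} → Axiom c s → ⊢ const c ∶ const s within ℬ
    scheme : ∀ {ℬ M A} → (M , A) ∈ ℬ → (σ : SortInst) →
            ⊢ instantiate σ M ∶ instantiate σ A within ℬ
    application : ∀ {ℬ M N A B} → ⊢ M ∶ pi A B within ℬ → ⊢ N ∶ A within ℬ →
            ⊢ app M N ∶ (B [ N ]) within ℬ
    conversion : ∀ {ℬ M A B s} → IsSort s → ⊢ M ∶ A within ℬ →
            ⊢ B ∶ const s within ℬ → A =β B → ⊢ M ∶ B within ℬ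
    type-reduction : ∀ {ℬ M A B} → ⊢ M ∶ A within ℬ → A →β B →
            ⊢ M ∶ B within ℬ
    subject-reduction : ∀ {ℬ M N A} → ⊢ M ∶ A within ℬ → M →β N →
            ⊢ N ∶ A within ℬ

HasEquivalentHPTS : PTSSpec → Set
HasEquivalentHPTS P =
  Σ (List (HPTS.Scheme P)) λ ℬ →
    ∀ M A → (PTS.Theorem P M A → HPTS.⊢_∶_within_ P M A ℬ)
          × (HPTS.⊢_∶_within_ P M A ℬ → PTS.Theorem P M A)

data Srt : Set where
  * □ : Srt

data AxiomStar : Srt → Srt → Set where
  *:□ : AxiomStar * □

data RuleArrow : Srt → Srt → Srt → Set where
  ***  : RuleArrow * * *

data RuleP : Srt → Srt → Srt → Set where
  ***  : RuleP * * *
  *□□ : RuleP * □ □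

λ→ : PTSSpec
λ→ = record { Const = Srt ; IsSort = λ _ → ⊤ ; Axiom = AxiomStar ; Rule = RuleArrow }

λP : PTSSpec
λP = record { Const = Srt ; IsSort = λ _ → ⊤ ; Axiom = AxiomStar ; Rule = RuleP }

-- In λ→ and λP every product rule starts with the sort *, and □ has no type.
-- Hence in the empty context the axiom * : □ is the only derivable judgement:
-- application and abstraction would need a theorem whose type is a Π, the
-- product rule would need a rule (□, s₂, s₃), and conversion could only retype
-- * : □ as * : *, which needs □ =β *, excluded by the Church–Rosser theorem
-- (confluence of parallel reduction, via Takahashi's complete developments).
-- Since the theorems are so few, the Hilbert-style system with no axiom
-- schemes is already equivalent.
module Submission where

open import Defs
open import Data.Nat using (ℕ; zero; suc)
open import Data.List using ([])
open import Data.Product using (∃; _×_; _,_)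
open import Data.Empty using (⊥-elim)
open import Data.Unit using (⊤)
open import Function.Base using (_∘_; id)
open import Function.Bundles using (_⇔_; mk⇔)
open import Relation.Nullary using (¬_)
open import Relation.Binary.PropositionalEquality
  using (_≡_; _≗_; refl; sym; trans; cong; cong₂)
open import Relation.Binary.Construct.Closure.ReflexiveTransitive
  using (Star; ε; _◅_; _◅◅_)
open import Relation.Binary.Rewriting using (Confluent)

module Substitution {C : Set} where

  Ren : Set
  Ren = ℕ → ℕ

  Sub : Set
  Sub = ℕ → Term C

  lift : Ren → Ren
  lift ρ zero    = zero
  lift ρ (suc n) = suc (ρ n)

  rename : Ren → Term C → Term C
  rename ρ (var n)   = var (ρ n)
  rename ρ (const k) = const k
  rename ρ (pi A B)  = pi (rename ρ A) (rename (lift ρ) B)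
  rename ρ (lam A M) = lam (rename ρ A) (rename (lift ρ) M)
  rename ρ (app M N) = app (rename ρ M) (rename ρ N)

  liftₛ : Sub → Sub
  liftₛ σ zero    = var zero
  liftₛ σ (suc n) = rename suc (σ n)

  subst : Sub → Term C → Term C
  subst σ (var n)   = σ n
  subst σ (const k) = const k
  subst σ (pi A B)  = pi (subst σ A) (subst (liftₛ σ) B)
  subst σ (lam A M) = lam (subst σ A) (subst (liftₛ σ) M)
  subst σ (app M N) = app (subst σ M) (subst σ N)

  sub₀ : Term C → Sub
  sub₀ N zero    = N
  sub₀ N (suc n) = var n

  lift-shiftVar : ∀ {ρ c} → ρ ≗ shiftVar {C} c → lift ρ ≗ shiftVar {C} (suc c)
  lift-shiftVar h zero    = refl
  lift-shiftVar h (suc n) = cong suc (h n)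

  shiftFrom≡rename : ∀ {ρ} c → ρ ≗ shiftVar {C} c → shiftFrom c ≗ rename ρ
  shiftFrom≡rename c h (var n)   = cong var (sym (h n))
  shiftFrom≡rename c h (const k) = refl
  shiftFrom≡rename c h (pi A B)  =
    cong₂ pi (shiftFrom≡rename c h A) (shiftFrom≡rename (suc c) (lift-shiftVar h) B)
  shiftFrom≡rename c h (lam A M) =
    cong₂ lam (shiftFrom≡rename c h A) (shiftFrom≡rename (suc c) (lift-shiftVar h) M)
  shiftFrom≡rename c h (app M N) =
    cong₂ app (shiftFrom≡rename c h M) (shiftFrom≡rename c h N)

  shift≡rename-suc : shift ≗ rename suc
  shift≡rename-suc = shiftFrom≡rename 0 (λ _ → refl)

  liftₛ-substVar : ∀ {σ c N} → σ ≗ substVar c N → liftₛ σ ≗ substVar (suc c) N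
  liftₛ-substVar h zero    = refl
  liftₛ-substVar h (suc n) = trans (cong (rename suc) (h n)) (sym (shift≡rename-suc _))

  substAt≡subst : ∀ {σ} c N → σ ≗ substVar c N → substAt c N ≗ subst σ
  substAt≡subst c N h (var n)   = sym (h n)
  substAt≡subst c N h (const k) = refl
  substAt≡subst c N h (pi A B)  =
    cong₂ pi (substAt≡subst c N h A) (substAt≡subst (suc c) N (liftₛ-substVar h) B)
  substAt≡subst c N h (lam A M) =
    cong₂ lam (substAt≡subst c N h A) (substAt≡subst (suc c) N (liftₛ-substVar h) M)
  substAt≡subst c N h (app M P) =
    cong₂ app (substAt≡subst c N h M) (substAt≡subst c N h P)

  []≡subst-sub₀ : ∀ M N → M [ N ] ≡ subst (sub₀ N) M
  []≡subst-sub₀ M N = substAt≡subst 0 N sub₀≡substVar M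
    where
    sub₀≡substVar : sub₀ N ≗ substVar 0 N
    sub₀≡substVar zero    = refl
    sub₀≡substVar (suc n) = refl

  lift-∘ : ∀ {ρ ρ′ ρ″} → ρ ∘ ρ′ ≗ ρ″ → lift ρ ∘ lift ρ′ ≗ lift ρ″
  lift-∘ h zero    = refl
  lift-∘ h (suc n) = cong suc (h n)

  rename-rename : ∀ {ρ ρ′ ρ″} → ρ ∘ ρ′ ≗ ρ″ → rename ρ ∘ rename ρ′ ≗ rename ρ″
  rename-rename h (var n)   = cong var (h n)
  rename-rename h (const k) = refl
  rename-rename h (pi A B)  = cong₂ pi (rename-rename h A) (rename-rename (lift-∘ h) B)
  rename-rename h (lam A M) = cong₂ lam (rename-rename h A) (rename-rename (lift-∘ h) M)
  rename-rename h (app M N) = cong₂ app (rename-rename h M) (rename-rename h N)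

  rename-lift-suc : ∀ ρ → rename (lift ρ) ∘ rename suc ≗ rename suc ∘ rename ρ
  rename-lift-suc ρ M =
    trans (rename-rename (λ _ → refl) M) (sym (rename-rename (λ _ → refl) M))

  rename-liftₛ : ∀ {ρ σ τ} → rename ρ ∘ σ ≗ τ → rename (lift ρ) ∘ liftₛ σ ≗ liftₛ τ
  rename-liftₛ h zero    = refl
  rename-liftₛ {ρ} {σ} h (suc n) =
    trans (rename-lift-suc ρ (σ n)) (cong (rename suc) (h n))

  rename-subst : ∀ {ρ σ τ} → rename ρ ∘ σ ≗ τ → rename ρ ∘ subst σ ≗ subst τ
  rename-subst h (var n)   = h n
  rename-subst h (const k) = refl
  rename-subst h (pi A B)  = cong₂ pi (rename-subst h A) (rename-subst (rename-liftₛ h) B)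
  rename-subst h (lam A M) = cong₂ lam (rename-subst h A) (rename-subst (rename-liftₛ h) M)
  rename-subst h (app M N) = cong₂ app (rename-subst h M) (rename-subst h N)

  liftₛ-lift : ∀ {σ ρ τ} → σ ∘ ρ ≗ τ → liftₛ σ ∘ lift ρ ≗ liftₛ τ
  liftₛ-lift h zero    = refl
  liftₛ-lift h (suc n) = cong (rename suc) (h n)

  subst-rename : ∀ {σ ρ τ} → σ ∘ ρ ≗ τ → subst σ ∘ rename ρ ≗ subst τ
  subst-rename h (var n)   = h n
  subst-rename h (const k) = refl
  subst-rename h (pi A B)  = cong₂ pi (subst-rename h A) (subst-rename (liftₛ-lift h) B)
  subst-rename h (lam A M) = cong₂ lam (subst-rename h A) (subst-rename (liftₛ-lift h) M)
  subst-rename h (app M N) = cong₂ app (subst-rename h M) (subst-rename h N)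

  subst-liftₛ-suc : ∀ σ → subst (liftₛ σ) ∘ rename suc ≗ rename suc ∘ subst σ
  subst-liftₛ-suc σ M =
    trans (subst-rename (λ _ → refl) M) (sym (rename-subst (λ _ → refl) M))

  liftₛ-subst : ∀ {σ τ υ} → subst σ ∘ τ ≗ υ → subst (liftₛ σ) ∘ liftₛ τ ≗ liftₛ υ
  liftₛ-subst h zero    = refl
  liftₛ-subst {σ} {τ} h (suc n) =
    trans (subst-liftₛ-suc σ (τ n)) (cong (rename suc) (h n))

  subst-subst : ∀ {σ τ υ} → subst σ ∘ τ ≗ υ → subst σ ∘ subst τ ≗ subst υ
  subst-subst h (var n)   = h n
  subst-subst h (const k) = refl
  subst-subst h (pi A B)  = cong₂ pi (subst-subst h A) (subst-subst (liftₛ-subst h) B)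
  subst-subst h (lam A M) = cong₂ lam (subst-subst h A) (subst-subst (liftₛ-subst h) M)
  subst-subst h (app M N) = cong₂ app (subst-subst h M) (subst-subst h N)

  liftₛ-var : ∀ {σ} → σ ≗ var → liftₛ σ ≗ var
  liftₛ-var h zero    = refl
  liftₛ-var h (suc n) = cong (rename suc) (h n)

  subst-var : ∀ {σ} → σ ≗ var → subst σ ≗ id
  subst-var h (var n)   = h n
  subst-var h (const k) = refl
  subst-var h (pi A B)  = cong₂ pi (subst-var h A) (subst-var (liftₛ-var h) B)
  subst-var h (lam A M) = cong₂ lam (subst-var h A) (subst-var (liftₛ-var h) M)
  subst-var h (app M N) = cong₂ app (subst-var h M) (subst-var h N)

  rename-sub₀ : ∀ ρ M N →
    rename ρ (subst (sub₀ N) M) ≡ subst (sub₀ (rename ρ N)) (rename (lift ρ) M)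
  rename-sub₀ ρ M N = trans (rename-subst commute M) (sym (subst-rename (λ _ → refl) M))
    where
    commute : rename ρ ∘ sub₀ N ≗ sub₀ (rename ρ N) ∘ lift ρ
    commute zero    = refl
    commute (suc n) = refl

  subst-sub₀ : ∀ σ M N →
    subst σ (subst (sub₀ N) M) ≡ subst (sub₀ (subst σ N)) (subst (liftₛ σ) M)
  subst-sub₀ σ M N = trans (subst-subst commute M) (sym (subst-subst (λ _ → refl) M))
    where
    commute : subst σ ∘ sub₀ N ≗ subst (sub₀ (subst σ N)) ∘ liftₛ σ
    commute zero    = refl
    commute (suc n) =
      sym (trans (subst-rename (λ _ → refl) (σ n)) (subst-var (λ _ → refl) (σ n)))

module ParallelReduction {C : Set} where
  open Substitution {C}

  infix 4 _⇒_ _⇒*_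

  data _⇒_ : Term C → Term C → Set where
    var   : ∀ {n} → var n ⇒ var n
    const : ∀ {k} → const k ⇒ const k
    pi    : ∀ {A A′ B B′} → A ⇒ A′ → B ⇒ B′ → pi A B ⇒ pi A′ B′
    lam   : ∀ {A A′ M M′} → A ⇒ A′ → M ⇒ M′ → lam A M ⇒ lam A′ M′
    app   : ∀ {M M′ N N′} → M ⇒ M′ → N ⇒ N′ → app M N ⇒ app M′ N′
    beta  : ∀ {A M M′ N N′} → M ⇒ M′ → N ⇒ N′ →
            app (lam A M) N ⇒ subst (sub₀ N′) M′

  _⇒*_ : Term C → Term C → Set
  _⇒*_ = Star _⇒_

  ⇒-refl : ∀ M → M ⇒ M
  ⇒-refl (var n)   = var
  ⇒-refl (const k) = const
  ⇒-refl (pi A B)  = pi (⇒-refl A) (⇒-refl B)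
  ⇒-refl (lam A M) = lam (⇒-refl A) (⇒-refl M)
  ⇒-refl (app M N) = app (⇒-refl M) (⇒-refl N)

  ⇒-rename : ∀ ρ {M N} → M ⇒ N → rename ρ M ⇒ rename ρ N
  ⇒-rename ρ var        = var
  ⇒-rename ρ const      = const
  ⇒-rename ρ (pi a b)   = pi (⇒-rename ρ a) (⇒-rename (lift ρ) b)
  ⇒-rename ρ (lam a m)  = lam (⇒-rename ρ a) (⇒-rename (lift ρ) m)
  ⇒-rename ρ (app m n)  = app (⇒-rename ρ m) (⇒-rename ρ n)
  ⇒-rename ρ (beta {M′ = M′} {N′ = N′} m n) rewrite rename-sub₀ ρ M′ N′ =
    beta (⇒-rename (lift ρ) m) (⇒-rename ρ n)

  ⇒-liftₛ : ∀ {σ τ} → (∀ n → σ n ⇒ τ n) → ∀ n → liftₛ σ n ⇒ liftₛ τ n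
  ⇒-liftₛ h zero    = var
  ⇒-liftₛ h (suc n) = ⇒-rename suc (h n)

  ⇒-subst : ∀ {σ τ} → (∀ n → σ n ⇒ τ n) → ∀ {M N} → M ⇒ N → subst σ M ⇒ subst τ N
  ⇒-subst h (var {n}) = h n
  ⇒-subst h const     = const
  ⇒-subst h (pi a b)  = pi (⇒-subst h a) (⇒-subst (⇒-liftₛ h) b)
  ⇒-subst h (lam a m) = lam (⇒-subst h a) (⇒-subst (⇒-liftₛ h) m)
  ⇒-subst h (app m n) = app (⇒-subst h m) (⇒-subst h n)
  ⇒-subst {τ = τ} h (beta {M′ = M′} {N′ = N′} m n) rewrite subst-sub₀ τ M′ N′ =
    beta (⇒-subst (⇒-liftₛ h) m) (⇒-subst h n)

  ⇒-sub₀ : ∀ {N N′} → N ⇒ N′ → ∀ n → sub₀ N n ⇒ sub₀ N′ n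
  ⇒-sub₀ p zero    = p
  ⇒-sub₀ p (suc n) = var

  develop : Term C → Term C
  develop (var n)             = var n
  develop (const k)           = const k
  develop (pi A B)            = pi (develop A) (develop B)
  develop (lam A M)           = lam (develop A) (develop M)
  develop (app (lam A M) N)   = subst (sub₀ (develop N)) (develop M)
  develop (app M N)           = app (develop M) (develop N)

  ⇒-develop : ∀ {M N} → M ⇒ N → N ⇒ develop M
  ⇒-develop var                  = var
  ⇒-develop const                = const
  ⇒-develop (pi a b)             = pi (⇒-develop a) (⇒-develop b)
  ⇒-develop (lam a m)            = lam (⇒-develop a) (⇒-develop m)
  ⇒-develop (app (lam a m) n)    = beta (⇒-develop m) (⇒-develop n)
  ⇒-develop (app m@var n)        = app (⇒-develop m) (⇒-develop n)
  ⇒-develop (app m@const n)      = app (⇒-develop m) (⇒-develop n)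
  ⇒-develop (app m@(pi _ _) n)   = app (⇒-develop m) (⇒-develop n)
  ⇒-develop (app m@(app _ _) n)  = app (⇒-develop m) (⇒-develop n)
  ⇒-develop (app m@(beta _ _) n) = app (⇒-develop m) (⇒-develop n)
  ⇒-develop (beta m n)           = ⇒-subst (⇒-sub₀ (⇒-develop n)) (⇒-develop m)

  strip : ∀ {M N₁ N₂} → M ⇒ N₁ → M ⇒* N₂ → ∃ λ P → N₁ ⇒* P × N₂ ⇒ P
  strip p ε       = _ , ε , p
  strip p (q ◅ r) with strip (⇒-develop q) r
  ... | P , s , t = P , ⇒-develop p ◅ s , t

  ⇒-confluent : Confluent _⇒_
  ⇒-confluent ε       q = _ , q , ε
  ⇒-confluent (p ◅ r) q with strip p q
  ... | P₁ , s , t with ⇒-confluent r s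
  ... | P , u , v = P , u , t ◅ v

  →β⇒⇒ : ∀ {M N} → M →β N → M ⇒ N
  →β⇒⇒ (beta {M = M} {N = N}) rewrite []≡subst-sub₀ M N = beta (⇒-refl M) (⇒-refl N)
  →β⇒⇒ (piL r)  = pi (→β⇒⇒ r) (⇒-refl _)
  →β⇒⇒ (piR r)  = pi (⇒-refl _) (→β⇒⇒ r)
  →β⇒⇒ (lamL r) = lam (→β⇒⇒ r) (⇒-refl _)
  →β⇒⇒ (lamR r) = lam (⇒-refl _) (→β⇒⇒ r)
  →β⇒⇒ (appL r) = app (→β⇒⇒ r) (⇒-refl _)
  →β⇒⇒ (appR r) = app (⇒-refl _) (→β⇒⇒ r)

  church-rosser : ∀ {M N} → M =β N → ∃ λ P → M ⇒* P × N ⇒* P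
  church-rosser (red r)       = _ , →β⇒⇒ r ◅ ε , ε
  church-rosser refl=         = _ , ε , ε
  church-rosser (sym= e) with church-rosser e
  ... | P , s , t = P , t , s
  church-rosser (trans= e f) with church-rosser e | church-rosser f
  ... | P₁ , s , t | P₂ , u , v with ⇒-confluent t u
  ... | P , w , x = P , s ◅◅ w , v ◅◅ x

  const-⇒* : ∀ {k P} → const k ⇒* P → P ≡ const k
  const-⇒* ε           = refl
  const-⇒* (const ◅ r) = const-⇒* r

  const-=β-injective : ∀ {k l} → const k =β const l → k ≡ l
  const-=β-injective e with church-rosser e
  ... | P , s , t with trans (sym (const-⇒* s)) (const-⇒* t)
  ... | refl = refl

open ParallelReduction using (const-=β-injective)

□≢β* : ¬ (const {Srt} □ =β const *)
□≢β* e with const-=β-injective e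
... | ()

module NoRuleFrom□ (Rule : Srt → Srt → Srt → Set)
                   (no-rule-from-□ : ∀ {s₂ s₃} → ¬ Rule □ s₂ s₃) where

  spec : PTSSpec
  spec = record { Const = Srt ; IsSort = λ _ → ⊤ ; Axiom = AxiomStar ; Rule = Rule }

  open PTS spec using (_⊢_∶_; Theorem)
  open HPTS spec using (⊢_∶_within_)
  open _⊢_∶_
  open ⊢_∶_within_

  theorem⇒*:□ : ∀ {M A} → Theorem M A → M ≡ const * × A ≡ const □
  theorem⇒*:□ (axiom *:□) = refl , refl
  theorem⇒*:□ (application d _) with theorem⇒*:□ d
  ... | _ , ()
  theorem⇒*:□ (abstraction _ _ d) with theorem⇒*:□ d
  ... | () , _
  theorem⇒*:□ (product _ d r) with theorem⇒*:□ d
  ... | refl , refl = ⊥-elim (no-rule-from-□ r)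
  theorem⇒*:□ (conversion _ d e c) with theorem⇒*:□ d | theorem⇒*:□ e
  ... | refl , refl | refl , refl = ⊥-elim (□≢β* c)

  *:□⇒theorem : ∀ {M A} → M ≡ const * × A ≡ const □ → Theorem M A
  *:□⇒theorem (refl , refl) = axiom *:□

  theorem⇔*:□ : ∀ M A → Theorem M A ⇔ (M ≡ const * × A ≡ const □)
  theorem⇔*:□ M A = mk⇔ theorem⇒*:□ *:□⇒theorem

  *:□⇒hilbert : ∀ {M A} → M ≡ const * × A ≡ const □ → ⊢ M ∶ A within []
  *:□⇒hilbert (refl , refl) = axiom *:□

  hilbert⇒*:□ : ∀ {M A} → ⊢ M ∶ A within [] → M ≡ const * × A ≡ const □
  hilbert⇒*:□ (axiom *:□) = refl , refl
  hilbert⇒*:□ (scheme () _)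
  hilbert⇒*:□ (application d _) with hilbert⇒*:□ d
  ... | _ , ()
  hilbert⇒*:□ (conversion _ d e c) with hilbert⇒*:□ d | hilbert⇒*:□ e
  ... | refl , refl | refl , refl = ⊥-elim (□≢β* c)
  hilbert⇒*:□ (type-reduction d r) with hilbert⇒*:□ d | r
  ... | refl , refl | ()
  hilbert⇒*:□ (subject-reduction d r) with hilbert⇒*:□ d | r
  ... | refl , refl | ()

  equivalentHPTS : HasEquivalentHPTS spec
  equivalentHPTS = [] , λ M A →
    (*:□⇒hilbert ∘ theorem⇒*:□) , (*:□⇒theorem ∘ hilbert⇒*:□)

corollary10 :
  (HasEquivalentHPTS λ→
    × (∀ M A → PTS.Theorem λ→ M A ⇔ (M ≡ const * × A ≡ const □)))
  × (HasEquivalentHPTS λP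
    × (∀ M A → PTS.Theorem λP M A ⇔ (M ≡ const * × A ≡ const □)))
corollary10 =
  (λ→.equivalentHPTS , λ→.theorem⇔*:□) , (λP.equivalentHPTS , λP.theorem⇔*:□)
  where
  module λ→ = NoRuleFrom□ RuleArrow (λ ())
  module λP = NoRuleFrom□ RuleP (λ ())
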